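{- Let $G$ be a $!$-graph and $b \in {!}(G)$. Then the $\mathcal{G}_{T!}$-typed graphs $\mathrm{COPY}_b(G)$, $\mathrm{DROP}_b(G)$ and $\mathrm{KILL}_b(G)$ are all $!$-graphs.
   Context: Fix a compressed monoidal signature $T=(O,M,\mathrm{dom},\mathrm{cod})$, $\mathrm{dom},\mathrm{cod}: M \rightarrow (O\times\{\mathsf{v},\mathsf{f}\})^*$. The derived compressed typegraph $\mathcal{G}_T$ has vertex set $O\sqcup M$, a self-loop on each $X\in O$, an edge $\mathrm{in}^a_{f,i}$ from $X$ to $f$ for each $f\in M$ and index $i$ with $\mathrm{dom}(f)[i]=(X,a)$, and an edge $\mathrm{out}^a_{f,j}$ from $f$ to $X$ for each index $j$ with $\mathrm{cod}(f)[j]=(X,a)$. $\mathcal{G}_{T!}$ is $\mathcal{G}_T$ plus a vertex $!$, a self-loop on $!$, and an edge from $!$ to each vertex of $\mathcal{G}_T$. For a finite directed multigraph $G$ typed over $\mathcal{G}_{T!}$, vertices typed in $O$, $M$, $!$ are wire-, node-, $!$-vertices ($!(G)$ the set of $!$-vertices); fixed-arity edges are those typed by an $\mathsf{f}$-tagged edge; $U(G)$ deletes $!$-vertices and incident edges. A string graph is a $\mathcal{G}_T$-typed graph whose typing restricts at each node-vertex to a bijection on incident fixed-arity edges and whose wire-vertices have at most one incoming and one outgoing edge. An open subgraph $O'$ of a string graph $K$ is a string subgraph with no vertex adjacent to a wire-vertex outside $O'$ and no incident fixed-arity edge outside $O'$. $B(b)$ is the full subgraph on successors of a $!$-vertex $b$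 (vertices $v$ with an edge $b \rightarrow v$; by reflexivity $b \in B(b)$), $\beta(G)$ the full subgraph on $!$-vertices. A $!$-graph is a $\mathcal{G}_{T!}$-typed graph with $U(G)$ a string graph, $\beta(G)$ posetal (at most one edge between two vertices, edge relation a partial order), $U(B(b))$ open in $U(G)$ for each $!$-vertex $b$, and $B(b')\subseteq B(b)$ whenever $b'\in B(b)$. For a subgraph $H$ of $G$, $G\setminus H$ denotes the full subgraph of $G$ on the vertices not in $H$. The $!$-box operations are: $\mathrm{COPY}_b(G)$ is the pushout in $\mathbf{Graph}/\mathcal{G}_{T!}$ of the span $G \hookleftarrow G\setminus B(b) \hookrightarrow G$ of two copies of the inclusion; $\mathrm{DROP}_b(G) = G \setminus \{b\}$; $\mathrm{KILL}_b(G) = G\setminus B(b)$. -}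

module Defs where

open import Data.Bool using (Bool; true; false; not; _∨_; T)
open import Data.Empty using (⊥)
open import Data.Unit using (⊤; tt)
open import Data.Fin using (Fin)
open import Data.List using (List; length; lookup)
open import Data.List.Membership.Propositional using (_∈_)
open import Data.List.Relation.Unary.Any using (any?)
open import Data.Product using (Σ; _×_; _,_; proj₁; proj₂)
open import Data.Product.Properties using ()
open import Data.Sum using (_⊎_; inj₁; inj₂)
open import Relation.Nullary using (¬_; Dec; yes; no)
open import Relation.Nullary.Decidable using (⌊_⌋; _×-dec_)
open import Relation.Binary using (DecidableEquality)
open import Relation.Binary.PropositionalEquality using (_≡_; refl; subst; sym; trans)

data Tag : Set where
  v f : Tag    -- variable-arity / fixed-arity

record Signature : Set₁ where
  field
    O   : Set
    M   : Set
    dom : M → List (O × Tag)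
    cod : M → List (O × Tag)

module _ (S : Signature) where
  open Signature S

  -- The typegraph G_{T!}  (G_T is the full subgraph on O ⊔ M)

  data TV : Set where
    ob   : O → TV      -- wire types
    mo   : M → TV      -- node types
    bang : TV

  data TE : Set where
    loop    : O → TE
    inE     : (g : M) → Fin (length (dom g)) → TE
    outE    : (g : M) → Fin (length (cod g)) → TE
    bangLoop : TE
    bangToO : O → TE
    bangToM : M → TE

  tsrc : TE → TV
  tsrc (loop X)    = ob X
  tsrc (inE g i)   = ob (proj₁ (lookup (dom g) i))
  tsrc (outE g j)  = mo g
  tsrc bangLoop    = bang
  tsrc (bangToO X) = bang
  tsrc (bangToM g) = bang

  ttgt : TE → TV
  ttgt (loop X)    = ob X
  ttgt (inE g i)   = mo g
  ttgt (outE g j)  = ob (proj₁ (lookup (cod g) j))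
  ttgt bangLoop    = bang
  ttgt (bangToO X) = ob X
  ttgt (bangToM g) = mo g

  FixedT : TE → Set
  FixedT (inE g i)  = proj₂ (lookup (dom g) i) ≡ f
  FixedT (outE g j) = proj₂ (lookup (cod g) j) ≡ f
  FixedT _          = ⊥

  IsWireT : TV → Set
  IsWireT (ob _) = ⊤
  IsWireT _      = ⊥

  IsBangT : TV → Set
  IsBangT bang = ⊤
  IsBangT _    = ⊥

  isBangB : TV → Bool
  isBangB bang = true
  isBangB _    = false

  record Graph : Set₁ where
    field
      V    : Set
      E    : Set
      src  : E → V
      tgt  : E → V
      τV   : V → TV
      τE   : E → TE
      src-ok : ∀ e → τV (src e) ≡ tsrc (τE e)
      tgt-ok : ∀ e → τV (tgt e) ≡ ttgt (τE e)

  record Finite (G : Graph) : Set where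
    open Graph G
    field
      _≟V_   : DecidableEquality V
      _≟E_   : DecidableEquality E
      vs     : List V
      vs-all : ∀ x → x ∈ vs
      es     : List E
      es-all : ∀ e → e ∈ es

  module _ (G : Graph) where
    open Graph G

    _⟶_ : V → V → Set
    u ⟶ w = Σ E λ e → src e ≡ u × tgt e ≡ w

    Incident : V → E → Set
    Incident x e = src e ≡ x ⊎ tgt e ≡ x

    Full : (V → Bool) → Graph
    Full P = record
      { V = Σ V (λ x → T (P x))
      ; E = Σ E (λ e → T (P (src e)) × T (P (tgt e)))
      ; src = λ { (e , p , q) → (src e , p) }
      ; tgt = λ { (e , p , q) → (tgt e , q) }
      ; τV = λ x → τV (proj₁ x)
      ; τE = λ e → τE (proj₁ e)
      ; src-ok = λ { (e , p , q) → src-ok e }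
      ; tgt-ok = λ { (e , p , q) → tgt-ok e }
      }

    U : Graph
    U = Full (λ x → not (isBangB (τV x)))

    β : Graph
    β = Full (λ x → isBangB (τV x))

  module _ (G : Graph) where
    open Graph G
    record IsStringGraph : Set where
      field
        -- typed over G_T ⊆ G_{T!}
        noBang   : ∀ x → ¬ IsBangT (τV x)
        node-inj : ∀ n g → τV n ≡ mo g → ∀ e e' →
                   Incident G n e → FixedT (τE e) →
                   Incident G n e' → FixedT (τE e') →
                   τE e ≡ τE e' → e ≡ e'
        node-surj : ∀ n g → τV n ≡ mo g → ∀ t →
                    (tsrc t ≡ mo g ⊎ ttgt t ≡ mo g) → FixedT t →
                    Σ E λ e → Incident G n e × τE e ≡ t
        wire-in  : ∀ w → IsWireT (τV w) → ∀ e e' → tgt e ≡ w → tgt e' ≡ w → e ≡ e'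
        wire-out : ∀ w → IsWireT (τV w) → ∀ e e' → src e ≡ w → src e' ≡ w → e ≡ e'

  module _ (G : Graph) where
    open Graph G
    record Posetal : Set where
      field
        atMostOne : ∀ e e' → src e ≡ src e' → tgt e ≡ tgt e' → e ≡ e'
        ⟶-refl    : ∀ x → _⟶_ G x x
        ⟶-trans   : ∀ {x y z} → _⟶_ G x y → _⟶_ G y z → _⟶_ G x z
        ⟶-antisym : ∀ {x y} → _⟶_ G x y → _⟶_ G y x → x ≡ y

  module _ (G : Graph) where
    open Graph G
    record OpenFull (P : V → Bool) : Set where
      field
        string    : IsStringGraph (Full G P)
        wire-out  : ∀ e → T (P (src e)) → IsWireT (τV (tgt e)) → T (P (tgt e))
        wire-in   : ∀ e → T (P (tgt e)) → IsWireT (τV (src e)) → T (P (src e))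
        fixed-out : ∀ e → FixedT (τE e) → T (P (src e)) → T (P (tgt e))
        fixed-in  : ∀ e → FixedT (τE e) → T (P (tgt e)) → T (P (src e))

  module _ {G : Graph} (fin : Finite G) where
    open Graph G
    open Finite fin

    -- membership of w in B(b): is there an edge b → w ?
    inB : V → V → Bool
    inB b w = ⌊ any? (λ e → (src e ≟V b) ×-dec (tgt e ≟V w)) es ⌋

    record IsBangGraph : Set where
      field
        U-string : IsStringGraph (U G)
        β-posetal : Posetal (β G)
        B-open   : ∀ b → IsBangT (τV b) →
                   OpenFull (U G) (λ x → inB b (proj₁ x))
        B-nest   : ∀ b b' → IsBangT (τV b) → IsBangT (τV b') →
                   _⟶_ G b b' → ∀ w → _⟶_ G b' w → _⟶_ G b w

    DROP : V → Graph
    DROP b = Full G (λ x → not ⌊ x ≟V b ⌋)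

    KILL : V → Graph
    KILL b = Full G (λ x → not (inB b x))

    -- COPY_b(G): the (componentwise) pushout of G ↩ G∖B(b) ↪ G.
    -- Left copy: all of G.  Right copy: the vertices / edges not in
    -- G∖B(b); vertices of G∖B(b) are identified with the left copy.
    module _ (b : V) where
      V₂ : Set
      V₂ = Σ V (λ x → T (inB b x))

      E₂ : Set
      E₂ = Σ E (λ e → T (inB b (src e) ∨ inB b (tgt e)))

      CV : Set
      CV = V ⊎ V₂

      τCV : CV → TV
      τCV (inj₁ x)       = τV x
      τCV (inj₂ (x , _)) = τV x

      right′ : (x : V) (w : Bool) → inB b x ≡ w → CV
      right′ x true  eq = inj₂ (x , subst T (sym eq) tt)
      right′ x false eq = inj₁ x

      right : V → CV
      right x = right′ x (inB b x) refl

      τ-right′ : ∀ x w (eq : inB b x ≡ w) → τCV (right′ x w eq) ≡ τV x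
      τ-right′ x true  eq = refl
      τ-right′ x false eq = refl

      τ-right : ∀ x → τCV (right x) ≡ τV x
      τ-right x = τ-right′ x (inB b x) refl

      COPY : Graph
      COPY = record
        { V = CV
        ; E = E ⊎ E₂
        ; src = λ { (inj₁ e) → inj₁ (src e) ; (inj₂ (e , _)) → right (src e) }
        ; tgt = λ { (inj₁ e) → inj₁ (tgt e) ; (inj₂ (e , _)) → right (tgt e) }
        ; τV = τCV
        ; τE = λ { (inj₁ e) → τE e ; (inj₂ (e , _)) → τE e }
        ; src-ok = λ { (inj₁ e) → src-ok e
                     ; (inj₂ (e , _)) → trans (τ-right (src e)) (src-ok e) }
        ; tgt-ok = λ { (inj₁ e) → tgt-ok e
                     ; (inj₂ (e , _)) → trans (τ-right (tgt e)) (tgt-ok e) }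
        }

  BangGraph : Graph → Set
  BangGraph G = Σ (Finite G) (IsBangGraph)

-- Being a string graph is reflected along
-- morphisms of typed graphs that lift fixed-arity edges and are injective on the
-- edges at nodes and wires (string-reflect, U-string-reflect).
--
-- DROP and KILL are full subgraphs closed under fixed-arity edges, and every such
-- full subgraph of a !-graph is a !-graph (full-axioms).  COPY is studied through
-- its codiagonal fold : COPY_b(G) → G.  Its vertices over B(b) come in two copies,
-- and u → w is an edge exactly when fold u → fold w is one and u, w do not lie in
-- different copies (copy-⟶, not-apart).  Each axiom is checked in G and lifted
-- back; what makes this work is that B(b) is closed under successors of its
-- !-vertices and open in U(G) (box-successor, fixed-in-box, wire-tgt-in-box).

module Submission where

open import Defs
open import Data.Bool using (Bool; true; false; not; _∨_; T; T?)
open import Data.Bool.Properties using (T-irrelevant; T-∨)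
open import Data.Empty using (⊥; ⊥-elim)
open import Data.Unit using (⊤; tt)
open import Data.List using (List; []; _∷_; _++_; map)
open import Data.List.Membership.Propositional using (_∈_; lose)
open import Data.List.Membership.Propositional.Properties using (∈-map⁺; ∈-++⁺ˡ; ∈-++⁺ʳ)
open import Data.List.Relation.Unary.Any using (here; there; satisfied)
open import Data.Product using (Σ; _×_; _,_; proj₁; proj₂; swap)
open import Data.Sum using (_⊎_; inj₁; inj₂; [_,_])
import Data.Product.Properties as Product
import Data.Sum.Properties as Sum
open import Function using (id)
open import Function.Bundles using (Equivalence)
open import Relation.Nullary using (¬_; Dec; yes; no; Irrelevant)
open import Relation.Nullary.Decidable using (⌊_⌋; _×-dec_; toWitness; fromWitness)
open import Relation.Binary using (DecidableEquality)
open import Relation.Binary.PropositionalEquality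
  using (_≡_; _≢_; refl; subst; sym; trans; cong; cong₂)

module _ {A : Set} {B : A → Set} (B-irrelevant : ∀ a → Irrelevant (B a)) where

  Σ-≡ : {x y : Σ A B} → proj₁ x ≡ proj₁ y → x ≡ y
  Σ-≡ {a , p} {.a , q} refl = cong (a ,_) (B-irrelevant a p q)

  Σ-≟ : DecidableEquality A → DecidableEquality (Σ A B)
  Σ-≟ _≟_ = Product.≡-dec _≟_ (λ {a} p q → yes (B-irrelevant a p q))

T²-irrelevant : ∀ {a b} → Irrelevant (T a × T b)
T²-irrelevant (p , q) (p' , q') = cong₂ _,_ (T-irrelevant p p') (T-irrelevant q q')

T-not-contra : ∀ {a b} → (T b → T a) → T (not a) → T (not b)
T-not-contra {b = false} _ _ = tt
T-not-contra {false} {true} b⇒a _ = b⇒a tt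

T∨ˡ : ∀ {a b} → T a → T (a ∨ b)
T∨ˡ p = Equivalence.from T-∨ (inj₁ p)

T∨ʳ : ∀ {a b} → T b → T (a ∨ b)
T∨ʳ p = Equivalence.from T-∨ (inj₂ p)

record Listed (A : Set) : Set where
  field
    _≟_      : DecidableEquality A
    elements : List A
    complete : ∀ x → x ∈ elements

select : {A : Set} {P : A → Set} → (∀ x → Dec (P x)) → List A → List (Σ A P)
select P? [] = []
select P? (x ∷ xs) with P? x
... | yes p = (x , p) ∷ select P? xs
... | no _  = select P? xs

select-complete : {A : Set} {P : A → Set} (P? : ∀ x → Dec (P x)) →
                  (∀ x → Irrelevant (P x)) → ∀ {x} (p : P x) xs →
                  x ∈ xs → (x , p) ∈ select P? xs
select-complete P? irr p (y ∷ xs) x∈ with P? y | x∈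
... | yes q | here refl = here (cong (y ,_) (irr y p q))
... | yes q | there x∈xs = there (select-complete P? irr p xs x∈xs)
... | no ¬q | here refl = ⊥-elim (¬q p)
... | no ¬q | there x∈xs = select-complete P? irr p xs x∈xs

Σ-listed : {A : Set} {P : A → Set} → Listed A → (∀ x → Dec (P x)) →
           (∀ x → Irrelevant (P x)) → Listed (Σ A P)
Σ-listed LA P? irr = record
  { _≟_      = Σ-≟ irr _≟_
  ; elements = select P? elements
  ; complete = λ { (x , p) → select-complete P? irr p elements (complete x) }
  }
  where open Listed LA

⊎-listed : {A B : Set} → Listed A → Listed B → Listed (A ⊎ B)
⊎-listed LA LB = record
  { _≟_      = Sum.≡-dec A._≟_ B._≟_
  ; elements = map inj₁ A.elements ++ map inj₂ B.elements
  ; complete = λ { (inj₁ x) → ∈-++⁺ˡ (∈-map⁺ inj₁ (A.complete x))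
                 ; (inj₂ y) → ∈-++⁺ʳ (map inj₁ A.elements) (∈-map⁺ inj₂ (B.complete y)) }
  }
  where
  module A = Listed LA
  module B = Listed LB

module _ (S : Signature) where

  NotBang : TV S → Set
  NotBang t = T (not (isBangB S t))

  bang→T : ∀ t → IsBangT S t → T (isBangB S t)
  bang→T bang _ = tt

  T→bang : ∀ t → T (isBangB S t) → IsBangT S t
  T→bang bang _ = tt
  T→bang (ob _) ()
  T→bang (mo _) ()

  bang-not-NotBang : ∀ t → IsBangT S t → ¬ NotBang t
  bang-not-NotBang bang _ ()

  wire-NotBang : ∀ t → IsWireT S t → NotBang t
  wire-NotBang (ob _) _ = tt

  fixed-ends : ∀ t → FixedT S t → NotBang (tsrc S t) × NotBang (ttgt S t)
  fixed-ends (inE g i)  _ = tt , tt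
  fixed-ends (outE g j) _ = tt , tt

  finite : {G : Graph S} → Listed (Graph.V G) → Listed (Graph.E G) → Finite S G
  finite LV LE = record
    { _≟V_ = LV._≟_ ; vs = LV.elements ; vs-all = LV.complete
    ; _≟E_ = LE._≟_ ; es = LE.elements ; es-all = LE.complete }
    where
    module LV = Listed LV
    module LE = Listed LE

  module _ {G : Graph S} (fin : Finite S G) where
    open Graph G
    open Finite fin

    vertices : Listed V
    vertices = record { _≟_ = _≟V_ ; elements = vs ; complete = vs-all }

    edges : Listed E
    edges = record { _≟_ = _≟E_ ; elements = es ; complete = es-all }

    inB-sound : ∀ {c w} → T (inB S fin c w) → _⟶_ S G c w
    inB-sound p = satisfied (toWitness p)

    inB-complete : ∀ {c w} → _⟶_ S G c w → T (inB S fin c w)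
    inB-complete (e , s , t) = fromWitness (lose (es-all e) (s , t))

  Full-finite : (G : Graph S) → Finite S G → (P : Graph.V G → Bool) → Finite S (Full S G P)
  Full-finite G fin P =
    finite (Σ-listed (vertices fin) (λ x → T? (P x)) (λ _ → T-irrelevant))
           (Σ-listed (edges fin) (λ e → T? (P (src e)) ×-dec T? (P (tgt e))) (λ _ → T²-irrelevant))
    where open Graph G

  module _ (G : Graph S) where
    open Graph G

    fixed-in-U : ∀ e → FixedT S (τE e) → NotBang (τV (src e)) × NotBang (τV (tgt e))
    fixed-in-U e fe =
      subst NotBang (sym (src-ok e)) (proj₁ (fixed-ends (τE e) fe)) ,
      subst NotBang (sym (tgt-ok e)) (proj₂ (fixed-ends (τE e) fe))

    Full-lift : (P : V → Bool) → ∀ {x y} → _⟶_ S G x y → (px : T (P x)) (py : T (P y)) →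
                _⟶_ S (Full S G P) (x , px) (y , py)
    Full-lift P (d , refl , refl) px py = (d , px , py) , refl , refl

    Full-proj : (P : V → Bool) → ∀ {x y} → _⟶_ S (Full S G P) x y → _⟶_ S G (proj₁ x) (proj₁ y)
    Full-proj P ((d , _ , _) , refl , refl) = d , refl , refl

  record Hom (H K : Graph S) : Set where
    private
      module H = Graph H
      module K = Graph K
    field
      onV   : H.V → K.V
      onE   : H.E → K.E
      src-≡ : ∀ e → K.src (onE e) ≡ onV (H.src e)
      tgt-≡ : ∀ e → K.tgt (onE e) ≡ onV (H.tgt e)
      τV-≡  : ∀ x → K.τV (onV x) ≡ H.τV x
      τE-≡  : ∀ e → K.τE (onE e) ≡ H.τE e

    along-V : (Q : TV S → Set) → ∀ x → Q (H.τV x) → Q (K.τV (onV x))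
    along-V Q x = subst Q (sym (τV-≡ x))

    along-src : (Q : TV S → Set) → ∀ e → Q (H.τV (H.src e)) → Q (K.τV (K.src (onE e)))
    along-src Q e q = subst (λ z → Q (K.τV z)) (sym (src-≡ e)) (along-V Q (H.src e) q)

    along-tgt : (Q : TV S → Set) → ∀ e → Q (H.τV (H.tgt e)) → Q (K.τV (K.tgt (onE e)))
    along-tgt Q e q = subst (λ z → Q (K.τV z)) (sym (tgt-≡ e)) (along-V Q (H.tgt e) q)

    along-E : (Q : TE S → Set) → ∀ e → Q (H.τE e) → Q (K.τE (onE e))
    along-E Q e = subst Q (sym (τE-≡ e))

    back-E : (Q : TE S → Set) → ∀ e → Q (K.τE (onE e)) → Q (H.τE e)
    back-E Q e = subst Q (τE-≡ e)

    along-⟶ : ∀ {x y} → _⟶_ S H x y → _⟶_ S K (onV x) (onV y)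
    along-⟶ (e , refl , refl) = onE e , src-≡ e , tgt-≡ e

    along-Incident : ∀ {n e} → Incident S H n e → Incident S K (onV n) (onE e)
    along-Incident {e = e} (inj₁ s) = inj₁ (trans (src-≡ e) (cong onV s))
    along-Incident {e = e} (inj₂ t) = inj₂ (trans (tgt-≡ e) (cong onV t))

  U-hom : {H K : Graph S} → Hom H K → Hom (U S H) (U S K)
  U-hom h = record
    { onV   = λ { (x , q) → onV x , along-V NotBang x q }
    ; onE   = λ { (e , q₁ , q₂) → onE e , along-src NotBang e q₁ , along-tgt NotBang e q₂ }
    ; src-≡ = λ { (e , _ , _) → Σ-≡ (λ _ → T-irrelevant) (src-≡ e) }
    ; tgt-≡ = λ { (e , _ , _) → Σ-≡ (λ _ → T-irrelevant) (tgt-≡ e) }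
    ; τV-≡  = λ { (x , _) → τV-≡ x }
    ; τE-≡  = λ { (e , _) → τE-≡ e }
    }
    where open Hom h

  inclusion : (G : Graph S) (P : Graph.V G → Bool) → Hom (Full S G P) G
  inclusion G P = record
    { onV = proj₁ ; onE = proj₁
    ; src-≡ = λ { (_ , _ , _) → refl } ; tgt-≡ = λ { (_ , _ , _) → refl }
    ; τV-≡ = λ _ → refl ; τE-≡ = λ _ → refl }

  inclusion-injective : (G : Graph S) (P : Graph.V G → Bool) →
    ∀ e e' → Hom.onE (inclusion G P) e ≡ Hom.onE (inclusion G P) e' → e ≡ e'
  inclusion-injective G P e e' = Σ-≡ (λ _ → T²-irrelevant)

  module _ {G : Graph S} (P : Graph.V G → Bool) where
    open Graph G

    Full-Incident-proj : ∀ {n e} → Incident S (Full S G P) n e → Incident S G (proj₁ n) (proj₁ e)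
    Full-Incident-proj (inj₁ s) = inj₁ (cong proj₁ s)
    Full-Incident-proj (inj₂ t) = inj₂ (cong proj₁ t)

    Full-Incident-lift : ∀ {x e} {px : T (P x)} {p : T (P (src e)) × T (P (tgt e))} →
      Incident S G x e → Incident S (Full S G P) (x , px) (e , p)
    Full-Incident-lift (inj₁ s) = inj₁ (Σ-≡ (λ _ → T-irrelevant) s)
    Full-Incident-lift (inj₂ t) = inj₂ (Σ-≡ (λ _ → T-irrelevant) t)

  FixedClosed : (G : Graph S) → (Graph.V G → Bool) → Set
  FixedClosed G P = ∀ e → FixedT S (τE e) →
    (T (P (src e)) → T (P (tgt e))) × (T (P (tgt e)) → T (P (src e)))
    where open Graph G

  Lifts : {H K : Graph S} → Hom H K → Set
  Lifts {H} {K} h = ∀ n d → Incident S K (onV n) d → FixedT S (Graph.τE K d) →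
                    Σ (Graph.E H) λ e → Incident S H n e × onE e ≡ d
    where open Hom h

  module _ {H K : Graph S} (h : Hom H K) where
    private
      module H = Graph H
      module K = Graph K
    open Hom h

    string-reflect : IsStringGraph S K → Lifts h →
      (∀ n e e' → Incident S H n e → FixedT S (H.τE e) → Incident S H n e' →
         FixedT S (H.τE e') → onE e ≡ onE e' → e ≡ e') →
      (∀ e e' → IsWireT S (H.τV (H.tgt e)) → H.tgt e ≡ H.tgt e' → onE e ≡ onE e' → e ≡ e') →
      (∀ e e' → IsWireT S (H.τV (H.src e)) → H.src e ≡ H.src e' → onE e ≡ onE e' → e ≡ e') →
      IsStringGraph S H
    string-reflect sK lifts node-inj wire-in-inj wire-out-inj = record
      { noBang   = λ x bx → K-str.noBang (onV x) (along-V (IsBangT S) x bx)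
      ; node-inj = λ n g τn e e' ie fe ie' fe' τe≡τe' →
          node-inj n e e' ie fe ie' fe'
            (K-str.node-inj (onV n) g (trans (τV-≡ n) τn) (onE e) (onE e')
              (along-Incident ie) (along-E (FixedT S) e fe)
              (along-Incident ie') (along-E (FixedT S) e' fe')
              (trans (τE-≡ e) (trans τe≡τe' (sym (τE-≡ e')))))
      ; node-surj = node-surj
      ; wire-in  = λ w ww e e' te te' →
          wire-in-inj e e' (subst (λ z → IsWireT S (H.τV z)) (sym te) ww) (trans te (sym te'))
            (K-str.wire-in (onV w) (along-V (IsWireT S) w ww) (onE e) (onE e')
              (trans (tgt-≡ e) (cong onV te)) (trans (tgt-≡ e') (cong onV te')))
      ; wire-out = λ w ww e e' se se' →
          wire-out-inj e e' (subst (λ z → IsWireT S (H.τV z)) (sym se) ww) (trans se (sym se'))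
            (K-str.wire-out (onV w) (along-V (IsWireT S) w ww) (onE e) (onE e')
              (trans (src-≡ e) (cong onV se)) (trans (src-≡ e') (cong onV se')))
      }
      where
      module K-str = IsStringGraph sK
      node-surj : ∀ n g → H.τV n ≡ mo g → ∀ t → (tsrc S t ≡ mo g ⊎ ttgt S t ≡ mo g) →
                  FixedT S t → Σ H.E λ e → Incident S H n e × H.τE e ≡ t
      node-surj n g τn t adj ft with K-str.node-surj (onV n) g (trans (τV-≡ n) τn) t adj ft
      ... | d , inc , τd≡t with lifts n d inc (subst (FixedT S) (sym τd≡t) ft)
      ... | e , ie , e↦d = e , ie , trans (sym (τE-≡ e)) (trans (cong K.τE e↦d) τd≡t)

    -- lifting of fixed-arity edges passes to the non-! parts, where fixed-arity edges lie
    U-lifts : Lifts h → Lifts (U-hom h)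
    U-lifts lifts (x , _) (d , _) inc fd with lifts x d (Full-Incident-proj {K} _ inc) fd
    ... | e , ie , e↦d =
      (e , fixed-in-U H e fe) , Full-Incident-lift {H} _ ie , Σ-≡ (λ _ → T²-irrelevant) e↦d
      where
      fe : FixedT S (H.τE e)
      fe = back-E (FixedT S) e (subst (λ z → FixedT S (K.τE z)) (sym e↦d) fd)

  module _ {H K : Graph S} (h : Hom H K) where
    private
      module H = Graph H
    open Hom h

    U-string-reflect : IsStringGraph S (U S K) → Lifts h →
      (∀ n e e' → Incident S H n e → FixedT S (H.τE e) → Incident S H n e' →
         FixedT S (H.τE e') → onE e ≡ onE e' → e ≡ e') →
      (∀ e e' → NotBang (H.τV (H.src e)) → IsWireT S (H.τV (H.tgt e)) →
         H.tgt e ≡ H.tgt e' → onE e ≡ onE e' → e ≡ e') →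
      (∀ e e' → NotBang (H.τV (H.tgt e)) → IsWireT S (H.τV (H.src e)) →
         H.src e ≡ H.src e' → onE e ≡ onE e' → e ≡ e') →
      IsStringGraph S (U S H)
    U-string-reflect sUK lifts node-inj wire-in-inj wire-out-inj =
      string-reflect (U-hom h) sUK (U-lifts h lifts)
        (λ n e e' ie fe ie' fe' e≡e' → U-edge-≡ (node-inj (proj₁ n) (proj₁ e) (proj₁ e')
           (Full-Incident-proj {H} _ ie) fe (Full-Incident-proj {H} _ ie') fe' (cong proj₁ e≡e')))
        (λ { (e , q₁ , _) (e' , _) we te e≡e' →
           U-edge-≡ (wire-in-inj e e' q₁ we (cong proj₁ te) (cong proj₁ e≡e')) })
        (λ { (e , _ , q₂) (e' , _) we se e≡e' →
           U-edge-≡ (wire-out-inj e e' q₂ we (cong proj₁ se) (cong proj₁ e≡e')) })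
      where
      U-edge-≡ : {e e' : Graph.E (U S H)} → proj₁ e ≡ proj₁ e' → e ≡ e'
      U-edge-≡ = Σ-≡ (λ _ → T²-irrelevant)

  inclusion-lifts : (G : Graph S) (P : Graph.V G → Bool) → FixedClosed G P → Lifts (inclusion G P)
  inclusion-lifts G P closed (x , px) d (inj₁ refl) fd =
    (d , px , proj₁ (closed d fd) px) , inj₁ refl , refl
  inclusion-lifts G P closed (x , px) d (inj₂ refl) fd =
    (d , proj₂ (closed d fd) px , px) , inj₂ refl , refl

  full-string : (G : Graph S) → IsStringGraph S G → (P : Graph.V G → Bool) →
                FixedClosed G P → IsStringGraph S (Full S G P)
  full-string G sG P closed =
    string-reflect (inclusion G P) sG (inclusion-lifts G P closed)
      (λ _ e e' _ _ _ _ → inclusion-injective G P e e')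
      (λ e e' _ _ → inclusion-injective G P e e')
      (λ e e' _ _ → inclusion-injective G P e e')

  -- The conditions on β(G) and on the !-boxes B(c), stated directly in terms of
  -- the edges of G rather than through subgraphs; this form is easy to transport
  -- along the !-box operations, and it is equivalent to IsBangGraph.

  module _ (G : Graph S) where
    open Graph G
    private
      _⇒_ : V → V → Set
      _⇒_ = _⟶_ S G
      Bang Plain : V → Set
      Bang x  = IsBangT S (τV x)
      Plain x = NotBang (τV x)

    -- the edges of U(G) along which every !-box must be closed, forwards and backwards
    OpenForward OpenBackward : E → Set
    OpenForward e  = FixedT S (τE e) ⊎ IsWireT S (τV (tgt e))
    OpenBackward e = FixedT S (τE e) ⊎ IsWireT S (τV (src e))

    record BangAxioms : Set where
      field
        string    : IsStringGraph S (U S G)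
        -- β(G) is posetal; transitivity is the instance of nested with w a !-vertex
        unique    : ∀ e e' → Bang (src e) → Bang (tgt e) → src e ≡ src e' → tgt e ≡ tgt e' → e ≡ e'
        reflexive : ∀ x → Bang x → x ⇒ x
        antisym   : ∀ x y → Bang x → Bang y → x ⇒ y → y ⇒ x → x ≡ y
        nested    : ∀ c c' → Bang c → Bang c' → c ⇒ c' → ∀ w → c' ⇒ w → c ⇒ w
        open-fwd  : ∀ c → Bang c → ∀ e → Plain (src e) → Plain (tgt e) → OpenForward e →
                    c ⇒ src e → c ⇒ tgt e
        open-bwd  : ∀ c → Bang c → ∀ e → Plain (src e) → Plain (tgt e) → OpenBackward e →
                    c ⇒ tgt e → c ⇒ src e

    axioms⇒bang : (fin : Finite S G) → BangAxioms → IsBangGraph S fin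
    axioms⇒bang fin ax = record
      { U-string  = string
      ; β-posetal = record
        { atMostOne = λ { (e , p , q) (e' , _ , _) s t →
            Σ-≡ (λ _ → T²-irrelevant)
              (unique e e' (T→bang _ p) (T→bang _ q) (cong proj₁ s) (cong proj₁ t)) }
        ; ⟶-refl    = λ { (x , p) → Full-lift G isB (reflexive x (T→bang _ p)) p p }
        ; ⟶-trans   = λ { {x , px} {y , py} {z , pz} x⇒y y⇒z →
            Full-lift G isB (nested x y (T→bang _ px) (T→bang _ py) (Full-proj G isB x⇒y)
                                    z (Full-proj G isB y⇒z)) px pz }
        ; ⟶-antisym = λ { {x , px} {y , py} x⇒y y⇒x →
            Σ-≡ (λ _ → T-irrelevant) (antisym x y (T→bang _ px) (T→bang _ py)
                                        (Full-proj G isB x⇒y) (Full-proj G isB y⇒x)) }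
        }
      ; B-open = λ c bc → record
        { string    = full-string (U S G) string _ (box-closed c bc)
        ; wire-out  = λ { (e , q₁ , q₂) x w →
            inB-complete fin (open-fwd c bc e q₁ q₂ (inj₂ w) (inB-sound fin x)) }
        ; wire-in   = λ { (e , q₁ , q₂) x w →
            inB-complete fin (open-bwd c bc e q₁ q₂ (inj₂ w) (inB-sound fin x)) }
        ; fixed-out = λ e fe → proj₁ (box-closed c bc e fe)
        ; fixed-in  = λ e fe → proj₂ (box-closed c bc e fe)
        }
      ; B-nest = nested
      }
      where
      open BangAxioms ax
      isB : V → Bool
      isB x = isBangB S (τV x)
      box-closed : ∀ c → Bang c → FixedClosed (U S G) (λ x → inB S fin c (proj₁ x))
      box-closed c bc (e , q₁ , q₂) fe =
        (λ x → inB-complete fin (open-fwd c bc e q₁ q₂ (inj₁ fe) (inB-sound fin x))) ,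
        (λ x → inB-complete fin (open-bwd c bc e q₁ q₂ (inj₁ fe) (inB-sound fin x)))

    bang⇒axioms : (fin : Finite S G) → IsBangGraph S fin → BangAxioms
    bang⇒axioms fin bG = record
      { string    = U-string
      ; unique    = λ e e' be be' s t → cong proj₁ (atMostOne (β-edge e be be')
                      (β-edge e' (subst Bang s be) (subst Bang t be'))
                      (Σ-≡ (λ _ → T-irrelevant) s) (Σ-≡ (λ _ → T-irrelevant) t))
      ; reflexive = λ x bx → Full-proj G isB (⟶-refl (x , bang→T _ bx))
      ; antisym   = λ x y bx by x⇒y y⇒x → cong proj₁ (⟶-antisym {x , bang→T _ bx} {y , bang→T _ by}
                      (Full-lift G isB x⇒y _ _) (Full-lift G isB y⇒x _ _))
      ; nested    = B-nest
      ; open-fwd  = λ { c bc e q₁ q₂ (inj₁ fe) x → inB-sound fin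
                          (OpenFull.fixed-out (B-open c bc) (e , q₁ , q₂) fe (inB-complete fin x))
                      ; c bc e q₁ q₂ (inj₂ w) x → inB-sound fin
                          (OpenFull.wire-out (B-open c bc) (e , q₁ , q₂) (inB-complete fin x) w) }
      ; open-bwd  = λ { c bc e q₁ q₂ (inj₁ fe) x → inB-sound fin
                          (OpenFull.fixed-in (B-open c bc) (e , q₁ , q₂) fe (inB-complete fin x))
                      ; c bc e q₁ q₂ (inj₂ w) x → inB-sound fin
                          (OpenFull.wire-in (B-open c bc) (e , q₁ , q₂) (inB-complete fin x) w) }
      }
      where
      open IsBangGraph bG
      open Posetal β-posetal
      isB : V → Bool
      isB x = isBangB S (τV x)
      β-edge : ∀ e → Bang (src e) → Bang (tgt e) → Graph.E (β S G)
      β-edge e bs bt = e , bang→T _ bs , bang→T _ bt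

  module _ {H K : Graph S} (h : Hom H K) where
    open Hom h

    along-OpenForward : ∀ e → OpenForward H e → OpenForward K (onE e)
    along-OpenForward e (inj₁ fe) = inj₁ (along-E (FixedT S) e fe)
    along-OpenForward e (inj₂ w)  = inj₂ (along-tgt (IsWireT S) e w)

    along-OpenBackward : ∀ e → OpenBackward H e → OpenBackward K (onE e)
    along-OpenBackward e (inj₁ fe) = inj₁ (along-E (FixedT S) e fe)
    along-OpenBackward e (inj₂ w)  = inj₂ (along-src (IsWireT S) e w)

  full-axioms : (G : Graph S) → BangAxioms G → (P : Graph.V G → Bool) → FixedClosed G P →
                BangAxioms (Full S G P)
  full-axioms G ax P closed = record
    { string    = U-string-reflect (inclusion G P) string (inclusion-lifts G P closed)
                    (λ _ e e' _ _ _ _ → inclusion-injective G P e e')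
                    (λ e e' _ _ _ → inclusion-injective G P e e')
                    (λ e e' _ _ _ → inclusion-injective G P e e')
    ; unique    = λ { (e , _) (e' , _) be be' s t → Σ-≡ (λ _ → T²-irrelevant)
                      (unique e e' be be' (cong proj₁ s) (cong proj₁ t)) }
    ; reflexive = λ { (x , px) bx → lift (reflexive x bx) px px }
    ; antisym   = λ { (x , _) (y , _) bx by x⇒y y⇒x → Σ-≡ (λ _ → T-irrelevant)
                      (antisym x y bx by (proj x⇒y) (proj y⇒x)) }
    ; nested    = λ { (c , pc) (c' , _) bc bc' c⇒c' (w , pw) c'⇒w →
                      lift (nested c c' bc bc' (proj c⇒c') w (proj c'⇒w)) pc pw }
    ; open-fwd  = λ { (c , pc) bc (e , _ , pt) q₁ q₂ op c⇒s →
                      lift (open-fwd c bc e q₁ q₂ op (proj c⇒s)) pc pt }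
    ; open-bwd  = λ { (c , pc) bc (e , ps , _) q₁ q₂ op c⇒t →
                      lift (open-bwd c bc e q₁ q₂ op (proj c⇒t)) pc ps }
    }
    where
    open BangAxioms ax
    lift : ∀ {x y} → _⟶_ S G x y → (px : T (P x)) (py : T (P y)) →
           _⟶_ S (Full S G P) (x , px) (y , py)
    lift = Full-lift G P
    proj : ∀ {x y} → _⟶_ S (Full S G P) x y → _⟶_ S G (proj₁ x) (proj₁ y)
    proj = Full-proj G P

  module _ (G : Graph S) (fin : Finite S G) (ax : BangAxioms G)
           (b : Graph.V G) (bb : IsBangT S (Graph.τV G b)) where
    open Graph G
    open Finite fin
    open BangAxioms ax

    -- fixed-arity edges never meet the !-vertex b
    drop-closed : FixedClosed G (λ x → not ⌊ x ≟V b ⌋)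
    drop-closed e fe = (λ _ → differs (tgt e) (proj₂ (fixed-in-U G e fe))) ,
                       (λ _ → differs (src e) (proj₁ (fixed-in-U G e fe)))
      where
      differs : ∀ x → NotBang (τV x) → T (not ⌊ x ≟V b ⌋)
      differs x nx with x ≟V b
      ... | yes refl = bang-not-NotBang _ bb nx
      ... | no _     = tt

    -- B(b) is open, hence so is its complement
    kill-closed : FixedClosed G (λ x → not (inB S fin b x))
    kill-closed e fe =
      T-not-contra (λ t∈B → inB-complete fin (open-bwd b bb e q₁ q₂ (inj₁ fe) (inB-sound fin t∈B))) ,
      T-not-contra (λ s∈B → inB-complete fin (open-fwd b bb e q₁ q₂ (inj₁ fe) (inB-sound fin s∈B)))
      where
      q₁ : NotBang (τV (src e))
      q₁ = proj₁ (fixed-in-U G e fe)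
      q₂ : NotBang (τV (tgt e))
      q₂ = proj₂ (fixed-in-U G e fe)

  module Copy (G : Graph S) (fin : Finite S G) (ax : BangAxioms G)
              (b : Graph.V G) (bb : IsBangT S (Graph.τV G b)) where
    open Graph G
    open BangAxioms ax
    private
      C : Graph S
      C = COPY S fin b
      module C = Graph C
      _⇒_ : V → V → Set
      _⇒_ = _⟶_ S G
      _⇛_ : C.V → C.V → Set
      _⇛_ = _⟶_ S C
      InBox : V → Set
      InBox x = T (inB S fin b x)
      rt : V → C.V
      rt = right S fin b

    copy-finite : Finite S C
    copy-finite = finite
      (⊎-listed (vertices fin) (Σ-listed (vertices fin) (λ x → T? _) (λ _ → T-irrelevant)))
      (⊎-listed (edges fin) (Σ-listed (edges fin) (λ e → T? _) (λ _ → T-irrelevant)))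

    data RightView (x : V) : C.V → Set where
      in-box  : (p : InBox x) → RightView x (inj₂ (x , p))
      outside : ¬ InBox x → RightView x (inj₁ x)

    right-view : ∀ x → RightView x (rt x)
    right-view x = view (inB S fin b x) refl
      where
      view : ∀ w (eq : inB S fin b x ≡ w) → RightView x (right′ S fin b x w eq)
      view true  eq = in-box _
      view false eq = outside (λ p → subst T eq p)

    right-in : ∀ {x} (p : InBox x) → rt x ≡ inj₂ (x , p)
    right-in {x} p with rt x | right-view x
    ... | _ | in-box p'  = cong (λ q → inj₂ (x , q)) (T-irrelevant p' p)
    ... | _ | outside ¬p = ⊥-elim (¬p p)

    right-out : ∀ {x} → ¬ InBox x → rt x ≡ inj₁ x
    right-out {x} ¬p with rt x | right-view x
    ... | _ | in-box p  = ⊥-elim (¬p p)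
    ... | _ | outside _ = refl

    left≢right : ∀ {x y} → InBox y → inj₁ x ≢ rt y
    left≢right {y = y} p with rt y | right-view y
    ... | _ | in-box _   = λ ()
    ... | _ | outside ¬p = ⊥-elim (¬p p)

    foldV : C.V → V
    foldV (inj₁ x)       = x
    foldV (inj₂ (x , _)) = x

    foldE : C.E → E
    foldE (inj₁ e)       = e
    foldE (inj₂ (e , _)) = e

    fold-right : ∀ x → foldV (rt x) ≡ x
    fold-right x with rt x | right-view x
    ... | _ | in-box _  = refl
    ... | _ | outside _ = refl

    fold : Hom C G
    fold = record
      { onV   = foldV
      ; onE   = foldE
      ; src-≡ = λ { (inj₁ e) → refl ; (inj₂ (e , _)) → sym (fold-right (src e)) }
      ; tgt-≡ = λ { (inj₁ e) → refl ; (inj₂ (e , _)) → sym (fold-right (tgt e)) }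
      ; τV-≡  = λ { (inj₁ x) → refl ; (inj₂ _) → refl }
      ; τE-≡  = λ { (inj₁ e) → refl ; (inj₂ _) → refl }
      }

    First Second : C.V → Set
    First (inj₁ x) = InBox x
    First (inj₂ _) = ⊥
    Second (inj₁ _) = ⊥
    Second (inj₂ _) = ⊤

    Apart : C.V → C.V → Set
    Apart u w = (First u × Second w) ⊎ (Second u × First w)

    apart-sym : ∀ {u w} → Apart u w → Apart w u
    apart-sym (inj₁ (fu , sw)) = inj₂ (sw , fu)
    apart-sym (inj₂ (su , fw)) = inj₁ (fw , su)

    copies : ∀ u → InBox (foldV u) → First u ⊎ Second u
    copies (inj₁ x) p = inj₁ p
    copies (inj₂ _) _ = inj₂ tt

    first-in-box : ∀ u → First u → InBox (foldV u)
    first-in-box (inj₁ x) p = p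

    second-in-box : ∀ u → Second u → InBox (foldV u)
    second-in-box (inj₂ (x , p)) _ = p

    not-first-right : ∀ x → ¬ First (rt x)
    not-first-right x with rt x | right-view x
    ... | _ | in-box _   = λ ()
    ... | _ | outside ¬p = ¬p

    edge-not-apart : ∀ e → ¬ Apart (C.src e) (C.tgt e)
    edge-not-apart (inj₁ e) (inj₁ (_ , ()))
    edge-not-apart (inj₁ e) (inj₂ (() , _))
    edge-not-apart (inj₂ (e , _)) (inj₁ (fs , _)) = not-first-right (src e) fs
    edge-not-apart (inj₂ (e , _)) (inj₂ (_ , ft)) = not-first-right (tgt e) ft

    not-apart : ∀ {u w} → u ⇛ w → ¬ Apart u w
    not-apart (e , refl , refl) = edge-not-apart e

    apart-transfer : ∀ {a m w} → ¬ Apart a m → ¬ Apart m w →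
                     (InBox (foldV a) → InBox (foldV m)) → ¬ Apart a w
    apart-transfer {a} {m} ¬am ¬mw a→m (inj₁ (fa , sw)) with copies m (a→m (first-in-box a fa))
    ... | inj₁ fm = ¬mw (inj₁ (fm , sw))
    ... | inj₂ sm = ¬am (inj₁ (fa , sm))
    apart-transfer {a} {m} ¬am ¬mw a→m (inj₂ (sa , fw)) with copies m (a→m (second-in-box a sa))
    ... | inj₁ fm = ¬am (inj₂ (sa , fm))
    ... | inj₂ sm = ¬mw (inj₂ (sm , fw))

    fold-vertex-injective : ∀ u w → foldV u ≡ foldV w → ¬ Apart u w → u ≡ w
    fold-vertex-injective (inj₁ x) (inj₁ .x) refl _ = refl
    fold-vertex-injective (inj₂ (x , p)) (inj₂ (.x , q)) refl _ =
      cong inj₂ (Σ-≡ (λ _ → T-irrelevant) refl)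
    fold-vertex-injective (inj₁ x) (inj₂ (.x , q)) refl ¬apart = ⊥-elim (¬apart (inj₁ (q , tt)))
    fold-vertex-injective (inj₂ (x , p)) (inj₁ .x) refl ¬apart = ⊥-elim (¬apart (inj₂ (tt , p)))

    lift-edge : ∀ d u w → foldV u ≡ src d → foldV w ≡ tgt d → ¬ Apart u w →
                Σ C.E λ e → foldE e ≡ d × C.src e ≡ u × C.tgt e ≡ w
    lift-edge d (inj₁ _) (inj₁ _) refl refl _ = inj₁ d , refl , refl , refl
    lift-edge d (inj₂ (_ , p)) (inj₂ (_ , q)) refl refl _ =
      inj₂ (d , T∨ˡ p) , refl , right-in p , right-in q
    lift-edge d (inj₁ _) (inj₂ (_ , q)) refl refl ¬apart =
      inj₂ (d , T∨ʳ q) , refl , right-out (λ p → ¬apart (inj₁ (p , tt))) , right-in q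
    lift-edge d (inj₂ (_ , p)) (inj₁ _) refl refl ¬apart =
      inj₂ (d , T∨ˡ p) , refl , right-in p , right-out (λ q → ¬apart (inj₂ (tt , q)))

    copy-⟶ : ∀ {u w} → foldV u ⇒ foldV w → ¬ Apart u w → u ⇛ w
    copy-⟶ {u} {w} (d , s , t) ¬apart with lift-edge d u w (sym s) (sym t) ¬apart
    ... | e , _ , se , te = e , se , te

    box-successor : ∀ {c x} → IsBangT S (τV c) → InBox c → c ⇒ x → InBox x
    box-successor bc c∈B c⇒x = inB-complete fin (nested b _ bb bc (inB-sound fin c∈B) _ c⇒x)

    box-forward : ∀ d → NotBang (τV (src d)) → NotBang (τV (tgt d)) → OpenForward G d →
                  InBox (src d) → InBox (tgt d)
    box-forward d q₁ q₂ op s∈B = inB-complete fin (open-fwd b bb d q₁ q₂ op (inB-sound fin s∈B))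

    box-backward : ∀ d → NotBang (τV (src d)) → NotBang (τV (tgt d)) → OpenBackward G d →
                   InBox (tgt d) → InBox (src d)
    box-backward d q₁ q₂ op t∈B = inB-complete fin (open-bwd b bb d q₁ q₂ op (inB-sound fin t∈B))

    Touches : E → Set
    Touches d = T (inB S fin b (src d) ∨ inB S fin b (tgt d))

    fixed-in-box : ∀ d → FixedT S (τE d) → Touches d → InBox (src d) × InBox (tgt d)
    fixed-in-box d fd p =
      [ (λ s∈B → s∈B , box-forward d q₁ q₂ (inj₁ fd) s∈B) ,
        (λ t∈B → box-backward d q₁ q₂ (inj₁ fd) t∈B , t∈B) ] (Equivalence.to T-∨ p)
      where
      q₁ : NotBang (τV (src d))
      q₁ = proj₁ (fixed-in-U G d fd)
      q₂ : NotBang (τV (tgt d))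
      q₂ = proj₂ (fixed-in-U G d fd)

    wire-tgt-in-box : ∀ d → NotBang (τV (src d)) → IsWireT S (τV (tgt d)) → Touches d → InBox (tgt d)
    wire-tgt-in-box d q₁ w p =
      [ box-forward d q₁ (wire-NotBang _ w) (inj₂ w) , id ] (Equivalence.to T-∨ p)

    wire-src-in-box : ∀ d → NotBang (τV (tgt d)) → IsWireT S (τV (src d)) → Touches d → InBox (src d)
    wire-src-in-box d q₂ w p =
      [ id , box-backward d (wire-NotBang _ w) q₂ (inj₂ w) ] (Equivalence.to T-∨ p)

    -- Edges of COPY_b(G) with the same image in G are equal, unless they are the two
    -- copies of an edge touching B(b); so the fold is injective on any symmetric
    -- relation that never relates such twins.
    fold-injective : (Q : E → Set) (R : C.E → C.E → Set) → (∀ {e e'} → R e e' → R e' e) →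
                     (∀ d p → Q d → ¬ R (inj₁ d) (inj₂ (d , p))) →
                     ∀ e e' → Q (foldE e) → R e e' → foldE e ≡ foldE e' → e ≡ e'
    fold-injective Q R R-sym twins (inj₁ d) (inj₁ .d) _ _ refl = refl
    fold-injective Q R R-sym twins (inj₂ (d , p)) (inj₂ (.d , p')) _ _ refl =
      cong inj₂ (Σ-≡ (λ _ → T-irrelevant) refl)
    fold-injective Q R R-sym twins (inj₁ d) (inj₂ (.d , p)) q r refl = ⊥-elim (twins d p q r)
    fold-injective Q R R-sym twins (inj₂ (d , p)) (inj₁ .d) q r refl = ⊥-elim (twins d p q (R-sym r))

    open Hom fold

    -- the copy of y on the same side as u
    companion : C.V → V → C.V
    companion (inj₁ _) y = inj₁ y
    companion (inj₂ _) y = rt y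

    fold-companion : ∀ u y → foldV (companion u y) ≡ y
    fold-companion (inj₁ _) y = refl
    fold-companion (inj₂ _) y = fold-right y

    companion-not-apart : ∀ u y → ¬ Apart u (companion u y)
    companion-not-apart (inj₁ _) y (inj₁ (_ , ()))
    companion-not-apart (inj₁ _) y (inj₂ (() , _))
    companion-not-apart (inj₂ _) y (inj₂ (_ , fy)) = not-first-right y fy

    fold-lifts : Lifts fold
    fold-lifts u d (inj₁ s) _
      with lift-edge d u (companion u (tgt d)) (sym s) (fold-companion u (tgt d))
                     (companion-not-apart u (tgt d))
    ... | e , e↦d , se , _ = e , inj₁ se , e↦d
    fold-lifts u d (inj₂ t) _
      with lift-edge d (companion u (src d)) u (fold-companion u (src d)) (sym t)
                     (λ apart → companion-not-apart u (src d) (apart-sym apart))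
    ... | e , e↦d , _ , te = e , inj₂ te , e↦d

    -- twin copies of a fixed-arity edge meet no common vertex, as both of its ends are in B(b)
    fold-node-injective : ∀ n e e' → Incident S C n e → FixedT S (C.τE e) →
                          Incident S C n e' → FixedT S (C.τE e') → foldE e ≡ foldE e' → e ≡ e'
    fold-node-injective n e e' ie fe ie' _ =
      fold-injective (λ d → FixedT S (τE d)) (λ e e' → Incident S C n e × Incident S C n e')
        swap twins e e' (along-E (FixedT S) e fe) (ie , ie')
      where
      twins : ∀ d p → FixedT S (τE d) → ¬ (Incident S C n (inj₁ d) × Incident S C n (inj₂ (d , p)))
      twins d p fd (i , i') = [ at (proj₁ ends) , at (proj₂ ends) ] i'
        where
        ends : InBox (src d) × InBox (tgt d)
        ends = fixed-in-box d fd p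
        at : ∀ {y} → InBox y → rt y ≡ n → ⊥
        at y∈B y≡n = [ (λ s → left≢right y∈B (trans s (sym y≡n))) ,
                       (λ t → left≢right y∈B (trans t (sym y≡n))) ] i

    -- twin copies of an edge of U(G) into (out of) a wire end (start) in different copies
    fold-wire-in-injective : ∀ e e' → NotBang (C.τV (C.src e)) → IsWireT S (C.τV (C.tgt e)) →
                             C.tgt e ≡ C.tgt e' → foldE e ≡ foldE e' → e ≡ e'
    fold-wire-in-injective e e' q w =
      fold-injective (λ d → NotBang (τV (src d)) × IsWireT S (τV (tgt d)))
        (λ e e' → C.tgt e ≡ C.tgt e')
        sym (λ d p (q , w) → left≢right (wire-tgt-in-box d q w p))
        e e' (along-src NotBang e q , along-tgt (IsWireT S) e w)

    fold-wire-out-injective : ∀ e e' → NotBang (C.τV (C.tgt e)) → IsWireT S (C.τV (C.src e)) →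
                              C.src e ≡ C.src e' → foldE e ≡ foldE e' → e ≡ e'
    fold-wire-out-injective e e' q w =
      fold-injective (λ d → NotBang (τV (tgt d)) × IsWireT S (τV (src d)))
        (λ e e' → C.src e ≡ C.src e')
        sym (λ d p (q , w) → left≢right (wire-src-in-box d q w p))
        e e' (along-tgt NotBang e q , along-src (IsWireT S) e w)

    copy-string : IsStringGraph S (U S C)
    copy-string = U-string-reflect fold string fold-lifts
      fold-node-injective fold-wire-in-injective fold-wire-out-injective

    -- Each remaining axiom is obtained by projecting to G, applying the axiom
    -- there and lifting back with copy-⟶; the vertices involved are not apart
    -- because B(b) is closed under successors of its !-vertices.
    private
      bang↓ : ∀ x → IsBangT S (C.τV x) → IsBangT S (τV (foldV x))
      bang↓ = along-V (IsBangT S)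

    -- parallel edges between !-vertices are not twins: those are never parallel
    copy-unique : ∀ e e' → IsBangT S (C.τV (C.src e)) → IsBangT S (C.τV (C.tgt e)) →
                  C.src e ≡ C.src e' → C.tgt e ≡ C.tgt e' → e ≡ e'
    copy-unique e e' bs bt s t =
      fold-injective (λ _ → ⊤) (λ e e' → C.src e ≡ C.src e' × C.tgt e ≡ C.tgt e')
        (λ (s , t) → sym s , sym t) twins e e' tt (s , t)
        (unique (foldE e) (foldE e') (along-src (IsBangT S) e bs) (along-tgt (IsBangT S) e bt)
           (trans (src-≡ e) (trans (cong foldV s) (sym (src-≡ e'))))
           (trans (tgt-≡ e) (trans (cong foldV t) (sym (tgt-≡ e')))))
      where
      twins : ∀ d p → ⊤ → ¬ (inj₁ (src d) ≡ rt (src d) × inj₁ (tgt d) ≡ rt (tgt d))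
      twins d p _ (s , t) = [ (λ s∈B → left≢right s∈B s) , (λ t∈B → left≢right t∈B t) ]
                              (Equivalence.to T-∨ p)

    copy-reflexive : ∀ x → IsBangT S (C.τV x) → x ⇛ x
    copy-reflexive x bx = copy-⟶ (reflexive (foldV x) (bang↓ x bx)) (self-not-apart x)
      where
      self-not-apart : ∀ x → ¬ Apart x x
      self-not-apart (inj₁ _) (inj₁ (_ , ()))
      self-not-apart (inj₁ _) (inj₂ (() , _))
      self-not-apart (inj₂ _) (inj₁ (() , _))
      self-not-apart (inj₂ _) (inj₂ (_ , ()))

    copy-antisym : ∀ x y → IsBangT S (C.τV x) → IsBangT S (C.τV y) → x ⇛ y → y ⇛ x → x ≡ y
    copy-antisym x y bx by x⇛y y⇛x = fold-vertex-injective x y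
      (antisym (foldV x) (foldV y) (bang↓ x bx) (bang↓ y by) (along-⟶ x⇛y) (along-⟶ y⇛x))
      (not-apart x⇛y)

    copy-nested : ∀ c c' → IsBangT S (C.τV c) → IsBangT S (C.τV c') → c ⇛ c' → ∀ w → c' ⇛ w → c ⇛ w
    copy-nested c c' bc bc' c⇛c' w c'⇛w = copy-⟶
      (nested (foldV c) (foldV c') (bang↓ c bc) (bang↓ c' bc') (along-⟶ c⇛c')
              (foldV w) (along-⟶ c'⇛w))
      (apart-transfer (not-apart c⇛c') (not-apart c'⇛w)
         (λ c∈B → box-successor (bang↓ c bc) c∈B (along-⟶ c⇛c')))

    copy-open-fwd : ∀ c → IsBangT S (C.τV c) →
                    ∀ e → NotBang (C.τV (C.src e)) → NotBang (C.τV (C.tgt e)) →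
                    OpenForward C e → c ⇛ C.src e → c ⇛ C.tgt e
    copy-open-fwd c bc e q₁ q₂ op c⇛s = copy-⟶
      (subst (foldV c ⇒_) (tgt-≡ e)
         (open-fwd (foldV c) (bang↓ c bc) (foldE e)
            (along-src NotBang e q₁) (along-tgt NotBang e q₂) (along-OpenForward fold e op)
            (subst (foldV c ⇒_) (sym (src-≡ e)) (along-⟶ c⇛s))))
      (apart-transfer (not-apart c⇛s) (edge-not-apart e)
         (λ c∈B → box-successor (bang↓ c bc) c∈B (along-⟶ c⇛s)))

    copy-open-bwd : ∀ c → IsBangT S (C.τV c) →
                    ∀ e → NotBang (C.τV (C.src e)) → NotBang (C.τV (C.tgt e)) →
                    OpenBackward C e → c ⇛ C.tgt e → c ⇛ C.src e
    copy-open-bwd c bc e q₁ q₂ op c⇛t = copy-⟶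
      (subst (foldV c ⇒_) (src-≡ e)
         (open-bwd (foldV c) (bang↓ c bc) (foldE e)
            (along-src NotBang e q₁) (along-tgt NotBang e q₂) (along-OpenBackward fold e op)
            (subst (foldV c ⇒_) (sym (tgt-≡ e)) (along-⟶ c⇛t))))
      (apart-transfer (not-apart c⇛t) (λ apart → edge-not-apart e (apart-sym apart))
         (λ c∈B → box-successor (bang↓ c bc) c∈B (along-⟶ c⇛t)))

    copy-axioms : BangAxioms C
    copy-axioms = record
      { string    = copy-string
      ; unique    = copy-unique
      ; reflexive = copy-reflexive
      ; antisym   = copy-antisym
      ; nested    = copy-nested
      ; open-fwd  = copy-open-fwd
      ; open-bwd  = copy-open-bwd
      }

theorem4p15 : (S : Signature) (G : Graph S) (hG : BangGraph S G)
    (b : Graph.V G) → IsBangT S (Graph.τV G b) →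
    BangGraph S (COPY S (proj₁ hG) b)
    × BangGraph S (DROP S (proj₁ hG) b)
    × BangGraph S (KILL S (proj₁ hG) b)
theorem4p15 S G (fin , bG) b bb =
  (copy-finite , axioms⇒bang S _ copy-finite copy-axioms) ,
  (Full-finite S G fin _ , axioms⇒bang S _ _ (full-axioms S G ax _ (drop-closed S G fin ax b bb))) ,
  (Full-finite S G fin _ , axioms⇒bang S _ _ (full-axioms S G ax _ (kill-closed S G fin ax b bb)))
  where
  ax : BangAxioms S G
  ax = bang⇒axioms S G fin bG
  open Copy S G fin ax b bb
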